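{- Let $\mathcal{A}_{\mathbf S}$ be a nested Ish arrangement in $\mathbb{R}^n$ and let $m=\max\{|s|:s\in\bigcup_{i<j}S_{i,j}\}$. Let $\mathfrak{T}(\mathbf S)$ be the set of rooted plane trees with $n$ nodes labeled bijectively by $1,\dots,n$ such that (1) the root is the node $1$; (2) the node $1$ has $2m+2$ children; (3) every other node has exactly one child; (4) for every node $k\ne1$, either $\mathsf{lsib}(k)\in S^-_{1,k}$ or $\mathsf{rsib}(k)\in S^-_{k,1}$. Then $|\mathfrak{T}(\mathbf S)|=\prod_{k=2}^{n}(n+1+|S_{1,k}|-k)$.
   Context: A deformation of the braid arrangement in $\mathbb{R}^n$ is a finite set $\mathcal{A}$ of hyperplanes $x_i-x_j=s$ ($1\le i<j\le n$, $s\in\mathbb{Z}$), encoded by $\mathbf S=(S_{i,j})_{i<j}$, $S_{i,j}=\{s:(x_i-x_j=s)\in\mathcal{A}\}$, written $\mathcal{A}_{\mathbf S}$. For $i<j$: $S^-_{i,j}:=\{s\ge0:-s\in S_{i,j}\}$ and $S^-_{j,i}:=\{0\}\cup\{s>0:s\in S_{i,j}\}$. $\mathcal{A}_{\mathbf S}$ is a nested Ish arrangement if $0\in S_{i,j}$ for all $i<j$, $S_{i,j}=\{0\}$ whenever $i\ne1$, and $S_{1,j}\subseteq S_{1,k}$ whenever $1<j<k\le n$. In a rooted plane tree, a node is a vertex with at least one child and a leaf is a vertex with none; children are ordered left to right; for a non-root vertex $v$, $\mathsf{lsib}(v)$ (resp. $\mathsf{rsib}(v)$) is the number of children of its parent (nodes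 or leaves) to the left (resp. right) of $v$. -}

module Defs where

open import Data.Nat using (ℕ; zero; suc; _+_; _*_; _∸_; _⊔_; _≤_; _<_)
open import Data.Integer as ℤ using (ℤ; +_; ∣_∣)
open import Data.List using (List; []; _∷_; _++_; map; length; upTo; concat; concatMap; foldr)
open import Data.Nat.ListAction using (product)
open import Data.List.Relation.Unary.All using (All)
open import Data.List.Relation.Unary.Unique.Propositional using (Unique)
open import Data.List.Membership.Propositional using (_∈_)
open import Data.List.Relation.Binary.Permutation.Propositional using (_↭_)
open import Data.Product using (Σ; _×_)
open import Data.Sum using (_⊎_)
open import Data.Unit using (⊤)
open import Relation.Binary.PropositionalEquality using (_≡_)

-- Integer ranges of naturals:  fromTo a b = [a, a+1, ..., b]  (empty if b < a)

fromTo : ℕ → ℕ → List ℕ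
fromTo a b = map (λ x → a + x) (upTo (suc b ∸ a))

-- Deformations of the braid arrangement in ℝ^n.
-- S i j is a list representing the finite set S_{i,j} ⊆ ℤ (only 1 ≤ i < j ≤ n matter).

Family : Set
Family = ℕ → ℕ → List ℤ

IsDeformation : ℕ → Family → Set
IsDeformation n S = ∀ i j → 1 ≤ i → i < j → j ≤ n → Unique (S i j)

IsNestedIsh : ℕ → Family → Set
IsNestedIsh n S =
    (∀ i j → 1 ≤ i → i < j → j ≤ n → + 0 ∈ S i j)
  × (∀ i j → 1 < i → i < j → j ≤ n → ∀ s → s ∈ S i j → s ≡ + 0)
  × (∀ j k → 1 < j → j < k → k ≤ n → ∀ s → s ∈ S 1 j → s ∈ S 1 k)

-- S^-_{i,j} for i < j :  { s ≥ 0 : -s ∈ S_{i,j} }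
SminusLo : Family → ℕ → ℕ → ℕ → Set
SminusLo S i j s = ℤ.- (+ s) ∈ S i j

-- S^-_{j,i} for i < j :  {0} ∪ { s > 0 : s ∈ S_{i,j} }
SminusHi : Family → ℕ → ℕ → ℕ → Set
SminusHi S i j s = s ≡ 0 ⊎ (0 < s × + s ∈ S i j)

-- m = max { |s| : s ∈ ⋃_{1 ≤ i < j ≤ n} S_{i,j} }   (0 if the union is empty)
allShifts : ℕ → Family → List ℤ
allShifts n S = concatMap (λ j → concatMap (λ i → S i j) (fromTo 1 (j ∸ 1))) (fromTo 2 n)

mval : ℕ → Family → ℕ
mval n S = foldr (λ s acc → ∣ s ∣ ⊔ acc) 0 (allShifts n S)

-- Rooted plane trees.  A leaf is unlabeled; a node carries a label and has
-- at least one child (first child, then the remaining children left to right).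

data Tree : Set where
  leaf : Tree
  node : ℕ → Tree → List Tree → Tree

mutual
  labels : Tree → List ℕ
  labels leaf = []
  labels (node k c cs) = k ∷ (labels c ++ labelsF cs)

  labelsF : List Tree → List ℕ
  labelsF [] = []
  labelsF (t ∷ ts) = labels t ++ labelsF ts

OneChild : Tree → Set
OneChild leaf = ⊤
OneChild (node k c cs) = cs ≡ [] × OneChild c

-- A condition P lsib rsib label, to be checked at every non-root node.
Cond : Set₁
Cond = ℕ → ℕ → ℕ → Set

Here : Cond → ℕ → ℕ → Tree → Set
Here P l r leaf = ⊤
Here P l r (node k _ _) = P l r k

mutual
  SibOK : Cond → Tree → Set
  SibOK P leaf = ⊤
  SibOK P (node k c cs) =
    Here P 0 (length cs) c × SibOK P c × SibsOK P 1 (suc (length cs)) cs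

  -- SibsOK P l tot ts : ts are the children at positions l, l+1, ... among tot children
  SibsOK : Cond → ℕ → ℕ → List Tree → Set
  SibsOK P l tot [] = ⊤
  SibsOK P l tot (t ∷ ts) =
    Here P l (tot ∸ suc l) t × SibOK P t × SibsOK P (suc l) tot ts

cond4 : Family → Cond
cond4 S l r k = SminusLo S 1 k l ⊎ SminusHi S 1 k r

InT : ℕ → Family → Tree → Set
InT n S t =
  Σ Tree λ c → Σ (List Tree) λ cs →
      t ≡ node 1 c cs
    × length (c ∷ cs) ≡ 2 * mval n S + 2
    × All OneChild (c ∷ cs)
    × labels t ↭ fromTo 1 n
    × SibOK (cond4 S) t

rhs : ℕ → Family → ℕ
rhs n S = product (map (λ k → n + 1 + length (S 1 k) ∸ k) (fromTo 2 n))

module Submission where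

-- A tree of 𝔗(S) is the root 1 with N = 2m+2 (possibly empty) chains hanging below it, and
-- condition (4) only concerns the top node of each chain: a deeper node has lsib = rsib = 0,
-- and 0 ∈ S^-_{k,1}.  All such forests arise by inserting the labels n, n-1, ..., 2 in turn:
-- label k either becomes the new top of one of the 1 + |S_{1,k}| chains whose position
-- satisfies (4) for k, or goes directly below one of the n - k labels already placed.
-- Conversely, deleting the smallest label k leaves a forest of the same kind on the larger
-- labels, because a label j > k that becomes the top of a chain inherits (4) from k, as
-- S_{1,k} ⊆ S_{1,j}.  Hence every tree is built exactly once, and there are
-- ∏_{k=2}^{n} (1 + |S_{1,k}| + n - k) of them.

open import Defs
open import Data.Nat using (ℕ; zero; suc; _+_; _*_; _∸_; _⊔_; _≤_; _<_; _≟_; _≤?_; z≤n; s≤s; s≤s⁻¹)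
open import Data.Nat.Properties
open import Data.Nat.ListAction using (product)
open import Data.Integer as ℤ using (ℤ; +0; +[1+_]; -[1+_]; ∣_∣)
open import Data.List
  using (List; []; _∷_; _++_; length; map; concat; concatMap; filter; foldr; head; replicate;
         upTo; applyUpTo; cartesianProduct)
open import Data.List.Properties
  using (length-++; length-map; length-upTo; length-replicate; map-upTo; map-∘; map-cong; map-injective; ++-identityʳ;
         filter-all; filter-accept; filter-reject; filter-++; ∷-injectiveˡ; ∷-injectiveʳ)
open import Data.List.Membership.Propositional using (_∈_; _∉_; lose)
open import Data.List.Membership.Propositional.Properties
  using (∈-++⁺ˡ; ∈-++⁺ʳ; ∈-++⁻; ∈-map⁺; ∈-map⁻; ∈-filter⁺; ∈-filter⁻; ∈-upTo⁺; ∈-upTo⁻; ∈-concatMap⁺;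
         ∈-cartesianProduct⁺; ∈-cartesianProduct⁻)
open import Data.List.Membership.DecPropositional _≟_ using (_∈?_)
open import Data.List.Relation.Unary.Any using (here; there)
open import Data.List.Relation.Unary.All using (All; []; _∷_)
import Data.List.Relation.Unary.All as All
import Data.List.Relation.Unary.All.Properties as Allₚ
open import Data.List.Relation.Unary.AllPairs using (AllPairs; []; _∷_)
import Data.List.Relation.Unary.AllPairs as AllPairs
import Data.List.Relation.Unary.AllPairs.Properties as AllPairsₚ
open import Data.List.Relation.Unary.Unique.Propositional using (Unique)
import Data.List.Relation.Unary.Unique.Propositional.Properties as Unique
open import Data.List.Relation.Binary.Disjoint.Propositional using (Disjoint)
open import Data.List.Relation.Binary.Permutation.Propositional
  using (_↭_; ↭-refl; ↭-prep; ↭-swap; ↭-sym; ↭-trans; ↭⇒↭ₛ)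
open import Data.List.Relation.Binary.Permutation.Propositional.Properties
  using (shift; ++⁺ˡ; ++⁺ʳ; ∈-resp-↭; ↭-empty-inv; filter-↭; drop-∷)
open import Data.List.Relation.Binary.Permutation.Setoid.Properties using (Unique-resp-↭)
open import Data.Maybe using (Maybe; just; nothing)
open import Data.Maybe.Properties using (just-injective)
open import Data.Product using (Σ; ∃-syntax; _×_; _,_; proj₁; proj₂)
import Data.Product as Product
open import Data.Sum using (_⊎_; inj₁; inj₂)
import Data.Sum as Sum
open import Data.Unit using (⊤; tt)
open import Data.Empty using (⊥-elim)
open import Function.Base using (id; _∘_; _∋_)
open import Function.Bundles using (_⇔_; mk⇔)
open import Relation.Nullary using (yes; no; ¬?)
open import Relation.Binary.PropositionalEquality
  using (_≡_; _≢_; refl; sym; trans; cong; cong₂; subst; setoid; module ≡-Reasoning)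

length-cartesianProduct : ∀ {A B : Set} (xs : List A) (ys : List B) →
  length (cartesianProduct xs ys) ≡ length xs * length ys
length-cartesianProduct [] ys = refl
length-cartesianProduct (x ∷ xs) ys = begin
  length (map (x ,_) ys ++ cartesianProduct xs ys)
    ≡⟨ length-++ (map (x ,_) ys) ⟩
  length (map (x ,_) ys) + length (cartesianProduct xs ys)
    ≡⟨ cong₂ _+_ (length-map (x ,_) ys) (length-cartesianProduct xs ys) ⟩
  length ys + length xs * length ys ∎
  where open ≡-Reasoning

Unique-map⁺-on : ∀ {A B : Set} {f : A → B} {xs : List A} →
  (∀ {x y} → x ∈ xs → y ∈ xs → f x ≡ f y → x ≡ y) → Unique xs → Unique (map f xs)
Unique-map⁺-on inj [] = []
Unique-map⁺-on inj (x∉ ∷ u) =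
  Allₚ.map⁺ (All.tabulate λ y∈ fx≡fy → All.lookup x∉ y∈ (inj (here refl) (there y∈) fx≡fy))
  ∷ Unique-map⁺-on (λ x∈ y∈ → inj (there x∈) (there y∈)) u

Unique-++⁻ : ∀ {A : Set} (xs : List A) {ys} → Unique (xs ++ ys) →
  Unique xs × Unique ys × (∀ {x} → x ∈ xs → x ∉ ys)
Unique-++⁻ [] u = [] , u , λ ()
Unique-++⁻ (x ∷ xs) (x∉ ∷ u) with Unique-++⁻ xs u
... | uxs , uys , disjoint =
  Allₚ.++⁻ˡ xs x∉ ∷ uxs , uys ,
  λ { (here refl) y∈ → All.lookup (Allₚ.++⁻ʳ xs x∉) y∈ refl ; (there x∈) → disjoint x∈ }

∈-tail : ∀ {A : Set} {x z : A} {xs} → x ≢ z → z ∈ x ∷ xs → z ∈ xs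
∈-tail x≢z (here z≡x) = ⊥-elim (x≢z (sym z≡x))
∈-tail x≢z (there z∈) = z∈

∈-++⁻-∉ˡ : ∀ {A : Set} {z : A} xs {ys} → z ∉ xs → z ∈ xs ++ ys → z ∈ ys
∈-++⁻-∉ˡ xs z∉xs z∈ with ∈-++⁻ xs z∈
... | inj₁ z∈xs = ⊥-elim (z∉xs z∈xs)
... | inj₂ z∈ys = z∈ys

fromTo-unfold : ∀ {a b} → a ≤ b → fromTo a b ≡ a ∷ fromTo (suc a) b
fromTo-unfold {a} {b} a≤b rewrite +-∸-assoc 1 a≤b = cong₂ _∷_ (+-identityʳ a) (begin
  map (a +_) (applyUpTo suc (b ∸ a))   ≡⟨ cong (map (a +_)) (map-upTo suc (b ∸ a)) ⟨
  map (a +_) (map suc (upTo (b ∸ a)))  ≡⟨ map-∘ (upTo (b ∸ a)) ⟨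
  map ((a +_) ∘ suc) (upTo (b ∸ a))    ≡⟨ map-cong (+-suc a) (upTo (b ∸ a)) ⟩
  map (suc a +_) (upTo (b ∸ a))        ∎)
  where open ≡-Reasoning

fromTo-empty : ∀ {a b} → b < a → fromTo a b ≡ []
fromTo-empty b<a rewrite m≤n⇒m∸n≡0 b<a = refl

∈-fromTo⁺ : ∀ {a b x} → a ≤ x → x ≤ b → x ∈ fromTo a b
∈-fromTo⁺ {a} {b} a≤x x≤b = subst (_∈ fromTo a b) (m+[n∸m]≡n a≤x)
  (∈-map⁺ (a +_) (∈-upTo⁺ (∸-monoˡ-< (s≤s x≤b) a≤x)))

∈-fromTo⁻ : ∀ {a b x} → x ∈ fromTo a b → a ≤ x × x ≤ b
∈-fromTo⁻ {a} {b} x∈ with ∈-map⁻ (a +_) x∈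
... | y , y∈ , refl = m≤m+n a y ,
  ≤-trans (≤-reflexive (+-comm a y)) (s≤s⁻¹ (m≤o∸n⇒m+n≤o (suc y) a≤1+b y<1+b∸a))
  where
  y<1+b∸a : y < suc b ∸ a
  y<1+b∸a = ∈-upTo⁻ y∈
  a≤1+b : a ≤ suc b
  a≤1+b = <⇒≤ (m∸n≢0⇒n<m λ eq → n≮0 (subst (y <_) eq y<1+b∸a))

fromTo-increasing : ∀ a b → AllPairs _<_ (fromTo a b)
fromTo-increasing a b =
  AllPairsₚ.map⁺ (AllPairsₚ.applyUpTo⁺₁ id (suc b ∸ a) λ i<j _ → +-monoʳ-< a i<j)

length-fromTo : ∀ a b → length (fromTo a b) ≡ suc b ∸ a
length-fromTo a b = trans (length-map (a +_) (upTo (suc b ∸ a))) (length-upTo (suc b ∸ a))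

-- Forests of chains

Forest : Set
Forest = List (List ℕ)

delete : ℕ → List ℕ → List ℕ
delete k = filter (λ x → ¬? (x ≟ k))

deleteᶠ : ℕ → Forest → Forest
deleteᶠ k = map (delete k)

insertBelow : ℕ → ℕ → List ℕ → List ℕ
insertBelow j k [] = []
insertBelow j k (x ∷ xs) with x ≟ j
... | yes _ = x ∷ k ∷ xs
... | no _ = x ∷ insertBelow j k xs

insertBelowᶠ : ℕ → ℕ → Forest → Forest
insertBelowᶠ j k [] = []
insertBelowᶠ j k (w ∷ ws) with j ∈? w
... | yes _ = insertBelow j k w ∷ ws
... | no _ = w ∷ insertBelowᶠ j k ws

insertTopᶠ : ℕ → ℕ → Forest → Forest
insertTopᶠ i k [] = []
insertTopᶠ zero k (w ∷ ws) = (k ∷ w) ∷ ws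
insertTopᶠ (suc i) k (w ∷ ws) = w ∷ insertTopᶠ i k ws

data Place : Set where
  top below : ℕ → Place

insertᶠ : Place → ℕ → Forest → Forest
insertᶠ (top i) = insertTopᶠ i
insertᶠ (below j) = insertBelowᶠ j

Fits : Place → Forest → Set
Fits (top i) F = i < length F
Fits (below j) F = j ∈ concat F

headAt : ℕ → Forest → Maybe ℕ
headAt i [] = nothing
headAt zero (w ∷ ws) = head w
headAt (suc i) (w ∷ ws) = headAt i ws

length-insertBelow : ∀ j k w → j ∈ w → length (insertBelow j k w) ≡ suc (length w)
length-insertBelow j k (x ∷ xs) j∈ with x ≟ j
... | yes _ = refl
... | no x≢j = cong suc (length-insertBelow j k xs (∈-tail x≢j j∈))

length-insertBelowᶠ : ∀ j k F → length (insertBelowᶠ j k F) ≡ length F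
length-insertBelowᶠ j k [] = refl
length-insertBelowᶠ j k (w ∷ ws) with j ∈? w
... | yes _ = refl
... | no _ = cong suc (length-insertBelowᶠ j k ws)

length-insertTopᶠ : ∀ i k F → length (insertTopᶠ i k F) ≡ length F
length-insertTopᶠ i k [] = refl
length-insertTopᶠ zero k (w ∷ ws) = refl
length-insertTopᶠ (suc i) k (w ∷ ws) = cong suc (length-insertTopᶠ i k ws)

length-insertᶠ : ∀ p k F → length (insertᶠ p k F) ≡ length F
length-insertᶠ (top i) = length-insertTopᶠ i
length-insertᶠ (below j) = length-insertBelowᶠ j

insertBelow-↭ : ∀ j k w → j ∈ w → insertBelow j k w ↭ k ∷ w
insertBelow-↭ j k (x ∷ xs) j∈ with x ≟ j
... | yes _ = ↭-swap x k ↭-refl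
... | no x≢j = ↭-trans (↭-prep x (insertBelow-↭ j k xs (∈-tail x≢j j∈))) (↭-swap x k ↭-refl)

concat-insertBelowᶠ-↭ : ∀ j k F → j ∈ concat F → concat (insertBelowᶠ j k F) ↭ k ∷ concat F
concat-insertBelowᶠ-↭ j k (w ∷ ws) j∈ with j ∈? w
... | yes j∈w = ++⁺ʳ (concat ws) (insertBelow-↭ j k w j∈w)
... | no j∉w = ↭-trans (++⁺ˡ w (concat-insertBelowᶠ-↭ j k ws (∈-++⁻-∉ˡ w j∉w j∈)))
                       (shift k w (concat ws))

concat-insertTopᶠ-↭ : ∀ i k F → i < length F → concat (insertTopᶠ i k F) ↭ k ∷ concat F
concat-insertTopᶠ-↭ zero k (w ∷ ws) _ = ↭-refl
concat-insertTopᶠ-↭ (suc i) k (w ∷ ws) (s≤s i<) =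
  ↭-trans (++⁺ˡ w (concat-insertTopᶠ-↭ i k ws i<)) (shift k w (concat ws))

concat-insertᶠ-↭ : ∀ p k F → Fits p F → concat (insertᶠ p k F) ↭ k ∷ concat F
concat-insertᶠ-↭ (top i) = concat-insertTopᶠ-↭ i
concat-insertᶠ-↭ (below j) = concat-insertBelowᶠ-↭ j

head-insertBelow : ∀ j k w → head (insertBelow j k w) ≡ head w
head-insertBelow j k [] = refl
head-insertBelow j k (x ∷ xs) with x ≟ j
... | yes _ = refl
... | no _ = refl

heads-insertBelowᶠ : ∀ j k F → map head (insertBelowᶠ j k F) ≡ map head F
heads-insertBelowᶠ j k [] = refl
heads-insertBelowᶠ j k (w ∷ ws) with j ∈? w
... | yes _ = cong (_∷ map head ws) (head-insertBelow j k w)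
... | no _ = cong (head w ∷_) (heads-insertBelowᶠ j k ws)

headAt-heads : ∀ i F G → map head F ≡ map head G → headAt i F ≡ headAt i G
headAt-heads i [] [] eq = refl
headAt-heads zero (w ∷ F) (v ∷ G) eq = ∷-injectiveˡ eq
headAt-heads (suc i) (w ∷ F) (v ∷ G) eq = headAt-heads i F G (∷-injectiveʳ eq)

headAt-∈ : ∀ i F {x} → headAt i F ≡ just x → x ∈ concat F
headAt-∈ zero ((y ∷ w) ∷ ws) refl = here refl
headAt-∈ (suc i) (w ∷ ws) eq = ∈-++⁺ʳ w (headAt-∈ i ws eq)

headAt-insertTopᶠ : ∀ i k F → i < length F → headAt i (insertTopᶠ i k F) ≡ just k
headAt-insertTopᶠ zero k (w ∷ ws) _ = refl
headAt-insertTopᶠ (suc i) k (w ∷ ws) (s≤s i<) = headAt-insertTopᶠ i k ws i<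

delete-∉ : ∀ k w → k ∉ w → delete k w ≡ w
delete-∉ k w k∉ = filter-all (λ x → ¬? (x ≟ k)) (all-≢ w k∉)
  where
  all-≢ : ∀ w → k ∉ w → All (_≢ k) w
  all-≢ [] _ = []
  all-≢ (x ∷ xs) k∉ = (λ x≡k → k∉ (here (sym x≡k))) ∷ all-≢ xs (k∉ ∘ there)

delete-head : ∀ k w → delete k (k ∷ w) ≡ delete k w
delete-head k w = filter-reject (λ x → ¬? (x ≟ k)) (λ k≢k → k≢k refl)

delete-other : ∀ k x w → x ≢ k → delete k (x ∷ w) ≡ x ∷ delete k w
delete-other k x w = filter-accept (λ x → ¬? (x ≟ k))

concat-deleteᶠ : ∀ k F → concat (deleteᶠ k F) ≡ delete k (concat F)
concat-deleteᶠ k [] = refl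
concat-deleteᶠ k (w ∷ ws) = trans (cong (delete k w ++_) (concat-deleteᶠ k ws))
  (sym (filter-++ (λ x → ¬? (x ≟ k)) w (concat ws)))

deleteᶠ-∉ : ∀ k F → k ∉ concat F → deleteᶠ k F ≡ F
deleteᶠ-∉ k [] _ = refl
deleteᶠ-∉ k (w ∷ ws) k∉ =
  cong₂ _∷_ (delete-∉ k w (k∉ ∘ ∈-++⁺ˡ)) (deleteᶠ-∉ k ws (k∉ ∘ ∈-++⁺ʳ w))

delete-insertBelow : ∀ j k w → k ∉ w → delete k (insertBelow j k w) ≡ w
delete-insertBelow j k [] _ = refl
delete-insertBelow j k (x ∷ xs) k∉ with x ≟ j
... | yes _ = begin
  delete k (x ∷ k ∷ xs) ≡⟨ delete-other k x (k ∷ xs) x≢k ⟩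
  x ∷ delete k (k ∷ xs) ≡⟨ cong (x ∷_) (delete-head k xs) ⟩
  x ∷ delete k xs       ≡⟨ cong (x ∷_) (delete-∉ k xs (k∉ ∘ there)) ⟩
  x ∷ xs                ∎
  where
  open ≡-Reasoning
  x≢k : x ≢ k
  x≢k x≡k = k∉ (here (sym x≡k))
... | no _ = trans (delete-other k x (insertBelow j k xs) (λ x≡k → k∉ (here (sym x≡k))))
                   (cong (x ∷_) (delete-insertBelow j k xs (k∉ ∘ there)))

deleteᶠ-insertᶠ : ∀ p k F → k ∉ concat F → deleteᶠ k (insertᶠ p k F) ≡ F
deleteᶠ-insertᶠ (top i) k [] _ = refl
deleteᶠ-insertᶠ (top zero) k (w ∷ ws) k∉ =
  cong₂ _∷_ (trans (delete-head k w) (delete-∉ k w (k∉ ∘ ∈-++⁺ˡ))) (deleteᶠ-∉ k ws (k∉ ∘ ∈-++⁺ʳ w))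
deleteᶠ-insertᶠ (top (suc i)) k (w ∷ ws) k∉ =
  cong₂ _∷_ (delete-∉ k w (k∉ ∘ ∈-++⁺ˡ)) (deleteᶠ-insertᶠ (top i) k ws (k∉ ∘ ∈-++⁺ʳ w))
deleteᶠ-insertᶠ (below j) k [] _ = refl
deleteᶠ-insertᶠ (below j) k (w ∷ ws) k∉ with j ∈? w
... | yes _ = cong₂ _∷_ (delete-insertBelow j k w (k∉ ∘ ∈-++⁺ˡ)) (deleteᶠ-∉ k ws (k∉ ∘ ∈-++⁺ʳ w))
... | no _ = cong₂ _∷_ (delete-∉ k w (k∉ ∘ ∈-++⁺ˡ)) (deleteᶠ-insertᶠ (below j) k ws (k∉ ∘ ∈-++⁺ʳ w))

insertBelow-≢-∷ : ∀ j k xs → j ∈ xs → k ∉ xs → insertBelow j k xs ≢ k ∷ xs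
insertBelow-≢-∷ j k (y ∷ ys) _ k∉ eq =
  k∉ (here (just-injective (trans (sym (cong head eq)) (head-insertBelow j k (y ∷ ys)))))

insertBelow-injective : ∀ j j' k w → j ∈ w → j' ∈ w → k ∉ w →
  insertBelow j k w ≡ insertBelow j' k w → j ≡ j'
insertBelow-injective j j' k (x ∷ xs) j∈ j'∈ k∉ eq with x ≟ j | x ≟ j'
... | yes x≡j | yes x≡j' = trans (sym x≡j) x≡j'
... | yes _ | no x≢j' =
  ⊥-elim (insertBelow-≢-∷ j' k xs (∈-tail x≢j' j'∈) (k∉ ∘ there) (sym (∷-injectiveʳ eq)))
... | no x≢j | yes _ =
  ⊥-elim (insertBelow-≢-∷ j k xs (∈-tail x≢j j∈) (k∉ ∘ there) (∷-injectiveʳ eq))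
... | no x≢j | no x≢j' =
  insertBelow-injective j j' k xs (∈-tail x≢j j∈) (∈-tail x≢j' j'∈) (k∉ ∘ there) (∷-injectiveʳ eq)

insertBelowᶠ-injective : ∀ j j' k F → j ∈ concat F → j' ∈ concat F → k ∉ concat F →
  insertBelowᶠ j k F ≡ insertBelowᶠ j' k F → j ≡ j'
insertBelowᶠ-injective j j' k (w ∷ ws) j∈ j'∈ k∉ eq with j ∈? w | j' ∈? w
... | yes j∈w | yes j'∈w = insertBelow-injective j j' k w j∈w j'∈w (k∉ ∘ ∈-++⁺ˡ) (∷-injectiveˡ eq)
... | yes j∈w | no _ =
  ⊥-elim (1+n≢n (trans (sym (length-insertBelow j k w j∈w)) (cong length (∷-injectiveˡ eq))))
... | no _ | yes j'∈w =
  ⊥-elim (1+n≢n (trans (sym (length-insertBelow j' k w j'∈w)) (cong length (sym (∷-injectiveˡ eq)))))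
... | no j∉w | no j'∉w = insertBelowᶠ-injective j j' k ws
  (∈-++⁻-∉ˡ w j∉w j∈) (∈-++⁻-∉ˡ w j'∉w j'∈) (k∉ ∘ ∈-++⁺ʳ w) (∷-injectiveʳ eq)

insertTopᶠ-injective : ∀ i i' k F → insertTopᶠ i k F ≡ insertTopᶠ i' k F → i < length F → i ≡ i'
insertTopᶠ-injective zero zero k (w ∷ ws) _ _ = refl
insertTopᶠ-injective zero (suc i') k (w ∷ ws) eq _ = ⊥-elim (1+n≢n (cong length (∷-injectiveˡ eq)))
insertTopᶠ-injective (suc i) zero k (w ∷ ws) eq _ = ⊥-elim (1+n≢n (cong length (sym (∷-injectiveˡ eq))))
insertTopᶠ-injective (suc i) (suc i') k (w ∷ ws) eq (s≤s i<) =
  cong suc (insertTopᶠ-injective i i' k ws (∷-injectiveʳ eq) i<)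

insertᶠ-injective : ∀ p p' k F → k ∉ concat F → Fits p F → Fits p' F →
  insertᶠ p k F ≡ insertᶠ p' k F → p ≡ p'
insertᶠ-injective (top i) (top i') k F _ i< _ eq = cong top (insertTopᶠ-injective i i' k F eq i<)
insertᶠ-injective (below j) (below j') k F k∉ j∈ j'∈ eq = cong below (insertBelowᶠ-injective j j' k F j∈ j'∈ k∉ eq)
insertᶠ-injective (top i) (below j) k F k∉ i< _ eq = ⊥-elim (k∉ (headAt-∈ i F (begin
  headAt i F                     ≡⟨ headAt-heads i F (insertBelowᶠ j k F) (sym (heads-insertBelowᶠ j k F)) ⟩
  headAt i (insertBelowᶠ j k F)  ≡⟨ cong (headAt i) eq ⟨
  headAt i (insertTopᶠ i k F)    ≡⟨ headAt-insertTopᶠ i k F i< ⟩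
  just k                         ∎)))
  where open ≡-Reasoning
insertᶠ-injective (below j) (top i) k F k∉ j∈ i< eq =
  sym (insertᶠ-injective (top i) (below j) k F k∉ i< j∈ (sym eq))

OnHead : Cond → ℕ → ℕ → Maybe ℕ → Set
OnHead P l r nothing = ⊤
OnHead P l r (just k) = P l r k

HeadsSatisfy : Cond → ℕ → ℕ → Forest → Set
HeadsSatisfy P l tot [] = ⊤
HeadsSatisfy P l tot (w ∷ ws) = OnHead P l (tot ∸ suc l) (head w) × HeadsSatisfy P (suc l) tot ws

HeadsSatisfy-heads : ∀ P l tot F G → map head F ≡ map head G → HeadsSatisfy P l tot F → HeadsSatisfy P l tot G
HeadsSatisfy-heads P l tot [] [] _ _ = tt
HeadsSatisfy-heads P l tot (w ∷ F) (v ∷ G) eq (h , hs) =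
  subst (OnHead P l (tot ∸ suc l)) (∷-injectiveˡ eq) h ,
  HeadsSatisfy-heads P (suc l) tot F G (∷-injectiveʳ eq) hs

HeadsSatisfy-insertTopᶠ : ∀ P i l tot k F → HeadsSatisfy P l tot F →
  P (l + i) (tot ∸ suc (l + i)) k → HeadsSatisfy P l tot (insertTopᶠ i k F)
HeadsSatisfy-insertTopᶠ P i l tot k [] _ _ = tt
HeadsSatisfy-insertTopᶠ P zero l tot k (w ∷ ws) (_ , hs) p =
  subst (λ z → P z (tot ∸ suc z) k) (+-identityʳ l) p , hs
HeadsSatisfy-insertTopᶠ P (suc i) l tot k (w ∷ ws) (h , hs) p =
  h , HeadsSatisfy-insertTopᶠ P i (suc l) tot k ws hs (subst (λ z → P z (tot ∸ suc z) k) (+-suc l i) p)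

HeadsSatisfy-headAt : ∀ P i l tot k F → HeadsSatisfy P l tot F → headAt i F ≡ just k →
  P (l + i) (tot ∸ suc (l + i)) k
HeadsSatisfy-headAt P zero l tot k ((x ∷ w) ∷ ws) (h , _) refl =
  subst (λ z → P z (tot ∸ suc z) k) (sym (+-identityʳ l)) h
HeadsSatisfy-headAt P (suc i) l tot k (w ∷ ws) (_ , hs) eq =
  subst (λ z → P z (tot ∸ suc z) k) (sym (+-suc l i)) (HeadsSatisfy-headAt P i (suc l) tot k ws hs eq)

Inherits : Cond → ℕ → List ℕ → Set
Inherits P k xs = ∀ {l r} j → j ∈ xs → j ≢ k → P l r k → P l r j

OnHead-all : ∀ {P l r ys} → All (P l r) ys → OnHead P l r (head ys)
OnHead-all [] = tt
OnHead-all (p ∷ _) = p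

OnHead-delete : ∀ P k l r w → Inherits P k w → OnHead P l r (head w) → OnHead P l r (head (delete k w))
OnHead-delete P k l r [] _ _ = tt
OnHead-delete P k l r (x ∷ xs) inherits h with x ≟ k
... | no x≢k rewrite delete-other k x xs x≢k = h
... | yes refl rewrite delete-head x xs =
  OnHead-all (All.tabulate λ y∈ → inherited (∈-filter⁻ (λ y → ¬? (y ≟ x)) {xs = xs} y∈))
  where
  inherited : ∀ {y} → y ∈ xs × y ≢ x → P l r y
  inherited (y∈ , y≢x) = inherits _ (there y∈) y≢x h

HeadsSatisfy-deleteᶠ : ∀ P k l tot F → Inherits P k (concat F) →
  HeadsSatisfy P l tot F → HeadsSatisfy P l tot (deleteᶠ k F)
HeadsSatisfy-deleteᶠ P k l tot [] _ _ = tt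
HeadsSatisfy-deleteᶠ P k l tot (w ∷ ws) inherits (h , hs) =
  OnHead-delete P k l (tot ∸ suc l) w (λ j → inherits j ∘ ∈-++⁺ˡ) h ,
  HeadsSatisfy-deleteᶠ P k (suc l) tot ws (λ j → inherits j ∘ ∈-++⁺ʳ w) hs

PlaceOf : Place → Forest → ℕ → Set
PlaceOf (top i) F k = i < length F × headAt i F ≡ just k
PlaceOf (below j) F k = j ∈ concat F × j ≢ k

insertBelow-delete : ∀ k w → Unique w → k ∈ w →
  (∃[ ys ] w ≡ k ∷ ys) ⊎ (∃[ j ] j ∈ w × j ≢ k × insertBelow j k (delete k w) ≡ w)
insertBelow-delete k (x ∷ xs) (x∉ ∷ u) k∈ with x ≟ k
... | yes refl = inj₁ (xs , refl)
... | no x≢k with insertBelow-delete k xs u (∈-tail x≢k k∈)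
...   | inj₁ (ys , refl) = inj₂ (x , here refl , x≢k , below-x)
  where
  below-x : insertBelow x k (delete k (x ∷ k ∷ ys)) ≡ x ∷ k ∷ ys
  below-x rewrite delete-other k x (k ∷ ys) x≢k | delete-head k ys
                | delete-∉ k ys (Unique.Unique[x∷xs]⇒x∉xs u) with x ≟ x
  ... | yes _ = refl
  ... | no x≢x = ⊥-elim (x≢x refl)
...   | inj₂ (j , j∈ , j≢k , eq) = inj₂ (j , there j∈ , j≢k , below-j)
  where
  below-j : insertBelow j k (delete k (x ∷ xs)) ≡ x ∷ xs
  below-j rewrite delete-other k x xs x≢k with x ≟ j
  ... | yes refl = ⊥-elim (All.lookup x∉ j∈ refl)
  ... | no _ = cong (x ∷_) eq

insertᶠ-deleteᶠ : ∀ k F → Unique (concat F) → k ∈ concat F →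
  ∃[ p ] PlaceOf p F k × insertᶠ p k (deleteᶠ k F) ≡ F
insertᶠ-deleteᶠ k (w ∷ ws) u k∈ with Unique-++⁻ w u | ∈-++⁻ w k∈
... | uw , _ , disjoint | inj₁ k∈w with insertBelow-delete k w uw k∈w
...   | inj₁ (ys , refl) = top 0 , (s≤s z≤n , refl) ,
        cong₂ _∷_ (cong (k ∷_) (trans (delete-head k ys) (delete-∉ k ys (Unique.Unique[x∷xs]⇒x∉xs uw))))
                  (deleteᶠ-∉ k ws (disjoint k∈w))
...   | inj₂ (j , j∈ , j≢k , eq) = below j , (∈-++⁺ˡ j∈ , j≢k) , below-j
  where
  below-j : insertBelowᶠ j k (deleteᶠ k (w ∷ ws)) ≡ w ∷ ws
  below-j with j ∈? delete k w
  ... | yes _ = cong₂ _∷_ eq (deleteᶠ-∉ k ws (disjoint k∈w))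
  ... | no j∉ = ⊥-elim (j∉ (∈-filter⁺ (λ x → ¬? (x ≟ k)) j∈ j≢k))
insertᶠ-deleteᶠ k (w ∷ ws) u k∈ | _ , uws , disjoint | inj₂ k∈ws
  with insertᶠ-deleteᶠ k ws uws k∈ws | delete-∉ k w (λ k∈w → disjoint k∈w k∈ws)
... | top i , (i< , h) , eq | w-kept = top (suc i) , (s≤s i< , h) , cong₂ _∷_ w-kept eq
... | below j , (j∈ , j≢k) , eq | w-kept = below j , (∈-++⁺ʳ w j∈ , j≢k) , below-j
  where
  below-j : insertBelowᶠ j k (deleteᶠ k (w ∷ ws)) ≡ w ∷ ws
  below-j rewrite w-kept with j ∈? w
  ... | yes j∈w = ⊥-elim (disjoint j∈w j∈)
  ... | no _ = cong (w ∷_) eq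

-- Trees whose non-root nodes have one child

chain : List ℕ → Tree
chain [] = leaf
chain (k ∷ ks) = node k (chain ks) []

toTree : Forest → Tree
toTree [] = leaf
toTree (w ∷ ws) = node 1 (chain w) (map chain ws)

labels-chain : ∀ w → labels (chain w) ≡ w
labels-chain [] = refl
labels-chain (k ∷ ks) = cong (k ∷_) (trans (++-identityʳ (labels (chain ks))) (labels-chain ks))

labelsF-map-chain : ∀ ws → labelsF (map chain ws) ≡ concat ws
labelsF-map-chain [] = refl
labelsF-map-chain (w ∷ ws) = cong₂ _++_ (labels-chain w) (labelsF-map-chain ws)

labels-toTree : ∀ w ws → labels (toTree (w ∷ ws)) ≡ 1 ∷ concat (w ∷ ws)
labels-toTree w ws = cong (1 ∷_) (cong₂ _++_ (labels-chain w) (labelsF-map-chain ws))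

OneChild-chain : ∀ w → OneChild (chain w)
OneChild-chain [] = tt
OneChild-chain (k ∷ ks) = refl , OneChild-chain ks

OneChild⇒chain : ∀ t → OneChild t → ∃[ w ] t ≡ chain w
OneChild⇒chain leaf _ = [] , refl
OneChild⇒chain (node k c .[]) (refl , oc) with OneChild⇒chain c oc
... | w , refl = k ∷ w , refl

All-OneChild⇒map-chain : ∀ cs → All OneChild cs → ∃[ ws ] cs ≡ map chain ws
All-OneChild⇒map-chain [] [] = [] , refl
All-OneChild⇒map-chain (c ∷ cs) (oc ∷ ocs) with OneChild⇒chain c oc | All-OneChild⇒map-chain cs ocs
... | w , refl | ws , refl = w ∷ ws , refl

node-injective : ∀ {k k' c c' cs cs'} → node k c cs ≡ node k' c' cs' → k ≡ k' × c ≡ c' × cs ≡ cs'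
node-injective refl = refl , refl , refl

chain-injective : ∀ {w v} → chain w ≡ chain v → w ≡ v
chain-injective {[]} {[]} _ = refl
chain-injective {x ∷ w} {y ∷ v} eq with node-injective eq
... | x≡y , c≡c' , _ = cong₂ _∷_ x≡y (chain-injective c≡c')

toTree-injective : ∀ {F G} → toTree F ≡ toTree G → F ≡ G
toTree-injective {[]} {[]} _ = refl
toTree-injective {w ∷ F} {v ∷ G} eq with node-injective eq
... | _ , c≡c' , cs≡cs' = cong₂ _∷_ (chain-injective c≡c') (map-injective chain-injective cs≡cs')

module _ (P : Cond) where

  Here-chain : ∀ l r w → Here P l r (chain w) ≡ OnHead P l r (head w)
  Here-chain l r [] = refl
  Here-chain l r (k ∷ ks) = refl

  SibsOK⇒HeadsSatisfy : ∀ l tot ws → SibsOK P l tot (map chain ws) → HeadsSatisfy P l tot ws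
  SibsOK⇒HeadsSatisfy l tot [] _ = tt
  SibsOK⇒HeadsSatisfy l tot (w ∷ ws) (h , _ , hs) =
    subst id (Here-chain l (tot ∸ suc l) w) h , SibsOK⇒HeadsSatisfy (suc l) tot ws hs

  SibOK⇒HeadsSatisfy : ∀ w ws → SibOK P (toTree (w ∷ ws)) → HeadsSatisfy P 0 (suc (length ws)) (w ∷ ws)
  SibOK⇒HeadsSatisfy w ws (h , _ , hs) rewrite length-map chain ws =
    subst id (Here-chain 0 (length ws) w) h , SibsOK⇒HeadsSatisfy 1 (suc (length ws)) ws hs

  module _ (P-only-child : ∀ k → P 0 0 k) where

    SibOK-chain : ∀ w → SibOK P (chain w)
    SibOK-chain [] = tt
    SibOK-chain (k ∷ ks) = only-child ks , SibOK-chain ks , tt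
      where
      only-child : ∀ ks → Here P 0 0 (chain ks)
      only-child [] = tt
      only-child (x ∷ _) = P-only-child x

    HeadsSatisfy⇒SibsOK : ∀ l tot ws → HeadsSatisfy P l tot ws → SibsOK P l tot (map chain ws)
    HeadsSatisfy⇒SibsOK l tot [] _ = tt
    HeadsSatisfy⇒SibsOK l tot (w ∷ ws) (h , hs) =
      subst id (sym (Here-chain l (tot ∸ suc l) w)) h , SibOK-chain w ,
      HeadsSatisfy⇒SibsOK (suc l) tot ws hs

    HeadsSatisfy⇒SibOK : ∀ w ws → HeadsSatisfy P 0 (suc (length ws)) (w ∷ ws) → SibOK P (toTree (w ∷ ws))
    HeadsSatisfy⇒SibOK w ws (h , hs) rewrite length-map chain ws =
      subst id (sym (Here-chain 0 (length ws) w)) h , SibOK-chain w ,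
      HeadsSatisfy⇒SibsOK 1 (suc (length ws)) ws hs

-- Generating the forests by inserting labels in decreasing order

module Enumeration
  (N : ℕ) (P : Cond) (Admissible : ℕ → Set) (positions : ℕ → List ℕ)
  (positions-unique : ∀ {k} → Admissible k → Unique (positions k))
  (positions-sound : ∀ {k i} → Admissible k → i ∈ positions k → i < N × P i (N ∸ suc i) k)
  (positions-complete : ∀ {k i} → i < N → P i (N ∸ suc i) k → i ∈ positions k)
  (P-inherited : ∀ {k j l r} → Admissible k → Admissible j → k < j → P l r k → P l r j)
  where

  ValidLabels : List ℕ → Set
  ValidLabels L = AllPairs _<_ L × All Admissible L

  IsForestOn : List ℕ → Forest → Set
  IsForestOn L F = length F ≡ N × concat F ↭ L × HeadsSatisfy P 0 N F

  places : ℕ → List ℕ → List Place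
  places k L = map top (positions k) ++ map below L

  extend : ℕ → Forest × Place → Forest
  extend k (G , p) = insertᶠ p k G

  forests : List ℕ → List Forest
  forests [] = replicate N [] ∷ []
  forests (k ∷ L) = map (extend k) (cartesianProduct (forests L) (places k L))

  count : List ℕ → ℕ
  count [] = 1
  count (k ∷ L) = (length (positions k) + length L) * count L

  InPlaces : ℕ → List ℕ → Place → Set
  InPlaces k L (top i) = i ∈ positions k
  InPlaces k L (below j) = j ∈ L

  ∈-places⁺ : ∀ {k L} p → InPlaces k L p → p ∈ places k L
  ∈-places⁺ {k} (top i) i∈ = ∈-++⁺ˡ (∈-map⁺ top i∈)
  ∈-places⁺ {k} (below j) j∈ = ∈-++⁺ʳ (map top (positions k)) (∈-map⁺ below j∈)

  ∈-places⁻ : ∀ {k L} p → p ∈ places k L → InPlaces k L p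
  ∈-places⁻ {k} p p∈ with ∈-++⁻ (map top (positions k)) p∈
  ∈-places⁻ (top i) _ | inj₁ q with ∈-map⁻ top q
  ... | _ , i∈ , refl = i∈
  ∈-places⁻ (below j) _ | inj₁ q with ∈-map⁻ top q
  ... | _ , _ , ()
  ∈-places⁻ (top i) _ | inj₂ q with ∈-map⁻ below q
  ... | _ , _ , ()
  ∈-places⁻ (below j) _ | inj₂ q with ∈-map⁻ below q
  ... | _ , j∈ , refl = j∈

  places-unique : ∀ {k L} → Admissible k → Unique L → Unique (places k L)
  places-unique {k} {L} adm uL =
    Unique.++⁺ (Unique.map⁺ (λ { refl → refl }) (positions-unique adm))
               (Unique.map⁺ (λ { refl → refl }) uL)
               disjoint
    where
    disjoint : Disjoint (map top (positions k)) (map below L)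
    disjoint (p∈ , p∈') with ∈-map⁻ top p∈ | ∈-map⁻ below p∈'
    ... | _ , _ , refl | _ , _ , ()

  ValidLabels⇒Unique : ∀ {L} → ValidLabels L → Unique L
  ValidLabels⇒Unique (increasing , _) = AllPairs.map <⇒≢ increasing

  smallest-∉ : ∀ {k L} → All (k <_) L → k ∉ L
  smallest-∉ k<L k∈ = <⇒≢ (All.lookup k<L k∈) refl

  Fits-places : ∀ {k L G} p → ValidLabels (k ∷ L) → IsForestOn L G → p ∈ places k L → Fits p G
  Fits-places (top i) (_ , adm ∷ _) (len , _) p∈ =
    subst (i <_) (sym len) (proj₁ (positions-sound adm (∈-places⁻ (top i) p∈)))
  Fits-places (below j) _ (_ , perm , _) p∈ = ∈-resp-↭ (↭-sym perm) (∈-places⁻ (below j) p∈)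

  extend-IsForestOn : ∀ {k L G} p → ValidLabels (k ∷ L) → IsForestOn L G → p ∈ places k L →
    IsForestOn (k ∷ L) (insertᶠ p k G)
  extend-IsForestOn {k} {L} {G} p valid G-on@(len , perm , heads) p∈ =
    trans (length-insertᶠ p k G) len ,
    ↭-trans (concat-insertᶠ-↭ p k G (Fits-places p valid G-on p∈)) (↭-prep k perm) ,
    heads-ok p (∈-places⁻ p p∈)
    where
    heads-ok : ∀ p → InPlaces k L p → HeadsSatisfy P 0 N (insertᶠ p k G)
    heads-ok (top i) i∈ = HeadsSatisfy-insertTopᶠ P i 0 N k G heads
      (proj₂ (positions-sound (All.head (proj₂ valid)) i∈))
    heads-ok (below j) _ = HeadsSatisfy-heads P 0 N G (insertBelowᶠ j k G) (sym (heads-insertBelowᶠ j k G)) heads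

  deleteᶠ-IsForestOn : ∀ {k L F} → ValidLabels (k ∷ L) → IsForestOn (k ∷ L) F → IsForestOn L (deleteᶠ k F)
  deleteᶠ-IsForestOn {k} {L} {F} (k<L ∷ _ , adm-k ∷ adm-L) (len , perm , heads) =
    trans (length-map (delete k) F) len ,
    subst (_↭ L) (sym (concat-deleteᶠ k F))
      (subst (delete k (concat F) ↭_) (trans (delete-head k L) (delete-∉ k L (smallest-∉ k<L)))
        (filter-↭ (λ x → ¬? (x ≟ k)) perm)) ,
    HeadsSatisfy-deleteᶠ P k 0 N F inherits heads
    where
    inherits : Inherits P k (concat F)
    inherits j j∈ j≢k with ∈-resp-↭ perm j∈
    ... | here j≡k = ⊥-elim (j≢k j≡k)
    ... | there j∈L = P-inherited adm-k (All.lookup adm-L j∈L) (All.lookup k<L j∈L)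

  empty-IsForestOn : IsForestOn [] (replicate N [])
  empty-IsForestOn = length-replicate N , subst (_↭ []) (sym (concat-empty N)) ↭-refl , heads-empty 0 N
    where
    concat-empty : ∀ n → concat (replicate n (List ℕ ∋ [])) ≡ []
    concat-empty zero = refl
    concat-empty (suc n) = concat-empty n
    heads-empty : ∀ l n → HeadsSatisfy P l N (replicate n [])
    heads-empty l zero = tt
    heads-empty l (suc n) = tt , heads-empty (suc l) n

  forests-sound : ∀ {L F} → ValidLabels L → F ∈ forests L → IsForestOn L F
  forests-sound {[]} _ (here refl) = empty-IsForestOn
  forests-sound {k ∷ L} valid@(_ ∷ increasing , _ ∷ adm) F∈ with ∈-map⁻ (extend k) F∈
  ... | (G , p) , x∈ , refl with ∈-cartesianProduct⁻ (forests L) (places k L) x∈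
  ...   | G∈ , p∈ = extend-IsForestOn p valid (forests-sound (increasing , adm) G∈) p∈

  forests-complete : ∀ {L F} → ValidLabels L → IsForestOn L F → F ∈ forests L
  forests-complete {[]} {F} _ (len , perm , _) =
    here (trans (all-empty F (↭-empty-inv perm)) (cong (λ n → replicate n []) len))
    where
    all-empty : ∀ F → concat F ≡ [] → F ≡ replicate (length F) []
    all-empty [] _ = refl
    all-empty ([] ∷ F) eq = cong ([] ∷_) (all-empty F eq)
  forests-complete {k ∷ L} {F} valid@(_ ∷ increasing , _ ∷ adm) F-on@(len , perm , heads)
    with insertᶠ-deleteᶠ k F (Unique-resp-↭ (setoid ℕ) (↭⇒↭ₛ (↭-sym perm)) (ValidLabels⇒Unique valid))
                             (∈-resp-↭ (↭-sym perm) (here refl))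
  ... | p , place , eq = subst (_∈ forests (k ∷ L)) eq
          (∈-map⁺ (extend k) (∈-cartesianProduct⁺ G∈ (∈-places⁺ p (in-places p place))))
    where
    G∈ : deleteᶠ k F ∈ forests L
    G∈ = forests-complete (increasing , adm) (deleteᶠ-IsForestOn valid F-on)
    in-places : ∀ p → PlaceOf p F k → InPlaces k L p
    in-places (top i) (i< , h) = positions-complete (subst (i <_) len i<)
      (HeadsSatisfy-headAt P i 0 N k F heads h)
    in-places (below j) (j∈ , j≢k) with ∈-resp-↭ perm j∈
    ... | here j≡k = ⊥-elim (j≢k j≡k)
    ... | there j∈L = j∈L

  forests-unique : ∀ {L} → ValidLabels L → Unique (forests L)
  forests-unique {[]} _ = [] ∷ []
  forests-unique {k ∷ L} valid@(k<L ∷ increasing , adm-k ∷ adm) =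
    Unique-map⁺-on extend-injective
      (Unique.cartesianProduct⁺ (forests-unique (increasing , adm))
                                (places-unique adm-k (ValidLabels⇒Unique (increasing , adm))))
    where
    k∉ : ∀ {G} → G ∈ forests L → k ∉ concat G
    k∉ G∈ k∈ = smallest-∉ k<L (∈-resp-↭ (proj₁ (proj₂ (forests-sound (increasing , adm) G∈))) k∈)
    fits : ∀ {G p} → G ∈ forests L → p ∈ places k L → Fits p G
    fits {p = p} G∈ p∈ = Fits-places p valid (forests-sound (increasing , adm) G∈) p∈
    extend-injective : ∀ {x y} → x ∈ cartesianProduct (forests L) (places k L) →
      y ∈ cartesianProduct (forests L) (places k L) → extend k x ≡ extend k y → x ≡ y
    extend-injective {G , p} {G' , p'} x∈ y∈ eq
      with G∈ , p∈ ← ∈-cartesianProduct⁻ (forests L) (places k L) x∈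
         | G'∈ , p'∈ ← ∈-cartesianProduct⁻ (forests L) (places k L) y∈
      with refl ← trans (sym (deleteᶠ-insertᶠ p k G (k∉ G∈)))
                        (trans (cong (deleteᶠ k) eq) (deleteᶠ-insertᶠ p' k G' (k∉ G'∈)))
      = cong (G ,_) (insertᶠ-injective p p' k G (k∉ G∈) (fits G∈ p∈) (fits G∈ p'∈) eq)

  length-forests : ∀ L → length (forests L) ≡ count L
  length-forests [] = refl
  length-forests (k ∷ L) = begin
    length (map (extend k) (cartesianProduct (forests L) (places k L)))
      ≡⟨ length-map (extend k) (cartesianProduct (forests L) (places k L)) ⟩
    length (cartesianProduct (forests L) (places k L))
      ≡⟨ length-cartesianProduct (forests L) (places k L) ⟩
    length (forests L) * length (places k L)
      ≡⟨ cong₂ _*_ (length-forests L) length-places ⟩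
    count L * (length (positions k) + length L)
      ≡⟨ *-comm (count L) _ ⟩
    count (k ∷ L) ∎
    where
    open ≡-Reasoning
    length-places : length (places k L) ≡ length (positions k) + length L
    length-places = trans (length-++ (map top (positions k)))
      (cong₂ _+_ (length-map top (positions k)) (length-map below L))

-- Nested Ish arrangements

∣∣≤foldr-⊔ : ∀ {s} xs → s ∈ xs → ∣ s ∣ ≤ foldr (λ s acc → ∣ s ∣ ⊔ acc) 0 xs
∣∣≤foldr-⊔ (x ∷ xs) (here refl) = m≤m⊔n _ _
∣∣≤foldr-⊔ (x ∷ xs) (there s∈) = ≤-trans (∣∣≤foldr-⊔ xs s∈) (m≤n⊔m _ _)

module NestedIsh (n : ℕ) (S : Family) (deformation : IsDeformation n S) (nested : IsNestedIsh n S) where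

  m : ℕ
  m = mval n S

  N : ℕ
  N = suc (suc (m + m))

  Admissible : ℕ → Set
  Admissible k = 2 ≤ k × k ≤ n

  shift-bound : ∀ {k s} → Admissible k → s ∈ S 1 k → ∣ s ∣ ≤ m
  shift-bound {k} (2≤k , k≤n) s∈ = ∣∣≤foldr-⊔ (allShifts n S)
    (∈-concatMap⁺ (λ j → concatMap (λ i → S i j) (fromTo 1 (j ∸ 1))) (lose (∈-fromTo⁺ 2≤k k≤n)
      (∈-concatMap⁺ (λ i → S i k) (lose (∈-fromTo⁺ ≤-refl (∸-monoˡ-≤ 1 2≤k)) s∈))))

  -- The child slot of k certified by s ∈ S_{1,k} in condition (4): lsib = -s if s ≤ 0, and
  -- rsib = s (slot N - 1 - s) if s > 0.  The only other admissible slot, N - 1, has rsib = 0.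
  position : ℤ → ℕ
  position +0 = 0
  position +[1+ r ] = m + m ∸ r
  position -[1+ r ] = suc r

  positions : ℕ → List ℕ
  positions k = suc (m + m) ∷ map position (S 1 k)

  position-bound : ∀ s → ∣ s ∣ ≤ m → position s ≤ m + m
  position-bound +0 _ = z≤n
  position-bound +[1+ r ] _ = m∸n≤m (m + m) r
  position-bound -[1+ r ] s≤m = ≤-trans s≤m (m≤m+n m m)

  <m⇒≤m+m : ∀ {r} → r < m → r ≤ m + m
  <m⇒≤m+m r<m = ≤-trans (<⇒≤ r<m) (m≤m+n m m)

  m<position-positive : ∀ r → suc r ≤ m → m < position +[1+ r ]
  m<position-positive r r<m = begin-strict
    m                ≡⟨ +-identityʳ m ⟨
    m + 0            <⟨ +-monoʳ-< m (m<n⇒0<n∸m r<m) ⟩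
    m + (m ∸ r)      ≡⟨ +-∸-assoc m (<⇒≤ r<m) ⟨
    m + m ∸ r        ∎
    where open ≤-Reasoning

  position-injective : ∀ s s' → ∣ s ∣ ≤ m → ∣ s' ∣ ≤ m → position s ≡ position s' → s ≡ s'
  position-injective +0 +0 _ _ _ = refl
  position-injective +0 +[1+ r' ] _ b' eq = ⊥-elim (<⇒≢ (≤-<-trans z≤n (m<position-positive r' b')) eq)
  position-injective +[1+ r ] +0 b _ eq = ⊥-elim (<⇒≢ (≤-<-trans z≤n (m<position-positive r b)) (sym eq))
  position-injective +[1+ r ] +[1+ r' ] b b' eq =
    cong +[1+_] (∸-cancelˡ-≡ (<m⇒≤m+m b) (<m⇒≤m+m b') eq)
  position-injective +[1+ r ] -[1+ r' ] b b' eq = ⊥-elim (<⇒≱ (m<position-positive r b) (subst (_≤ m) (sym eq) b'))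
  position-injective -[1+ r ] +[1+ r' ] b b' eq = ⊥-elim (<⇒≱ (m<position-positive r' b') (subst (_≤ m) eq b))
  position-injective -[1+ r ] -[1+ r' ] _ _ eq = cong -[1+_] (suc-injective eq)

  positions-unique : ∀ {k} → Admissible k → Unique (positions k)
  positions-unique {k} adm =
    All.tabulate top-fresh
    ∷ Unique-map⁺-on (λ {s} {s'} s∈ s'∈ → position-injective s s' (shift-bound adm s∈) (shift-bound adm s'∈))
                     (deformation 1 _ ≤-refl (proj₁ adm) (proj₂ adm))
    where
    top-fresh : ∀ {i} → i ∈ map position (S 1 k) → suc (m + m) ≢ i
    top-fresh i∈ eq with s , s∈ , refl ← ∈-map⁻ position i∈ =
      1+n≰n (subst (_≤ m + m) (sym eq) (position-bound s (shift-bound adm s∈)))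

  rsib-position-positive : ∀ r → r ≤ m + m → N ∸ suc (m + m ∸ r) ≡ suc r
  rsib-position-positive r r≤ = trans (+-∸-assoc 1 (m∸n≤m (m + m) r)) (cong suc (m∸[m∸n]≡n r≤))

  position-cond : ∀ {k} s → s ∈ S 1 k → ∣ s ∣ ≤ m → cond4 S (position s) (N ∸ suc (position s)) k
  position-cond +0 s∈ _ = inj₁ s∈
  position-cond -[1+ r ] s∈ _ = inj₁ s∈
  position-cond {k} +[1+ r ] s∈ s≤m = inj₂ (inj₂
    (subst (λ x → 0 < x × ℤ.+ x ∈ S 1 k) (sym (rsib-position-positive r (<m⇒≤m+m s≤m)))
           (s≤s z≤n , s∈)))

  positions-sound : ∀ {k i} → Admissible k → i ∈ positions k → i < N × cond4 S i (N ∸ suc i) k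
  positions-sound _ (here refl) = ≤-refl , inj₂ (inj₁ (n∸n≡0 (m + m)))
  positions-sound adm (there i∈) with s , s∈ , refl ← ∈-map⁻ position i∈ =
    s≤s (m≤n⇒m≤1+n (position-bound s (shift-bound adm s∈))) , position-cond s s∈ (shift-bound adm s∈)

  positions-complete : ∀ {k i} → i < N → cond4 S i (N ∸ suc i) k → i ∈ positions k
  -- splitting on i lets ℤ.- (ℤ.+ i) compute
  positions-complete {i = zero} _ (inj₁ s∈) = there (∈-map⁺ position s∈)
  positions-complete {i = suc r} _ (inj₁ s∈) = there (∈-map⁺ position s∈)
  positions-complete (s≤s i≤) (inj₂ (inj₁ eq)) = here (≤-antisym i≤ (m∸n≡0⇒m≤n eq))
  positions-complete {k} {i} (s≤s i≤) (inj₂ (inj₂ (0<x , x∈))) = there (positive _ refl 0<x x∈)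
    where
    positive : ∀ x → suc (m + m) ∸ i ≡ x → 0 < x → ℤ.+ x ∈ S 1 k → i ∈ map position (S 1 k)
    positive (suc r) eq _ x∈ = subst (_∈ map position (S 1 k))
      (trans (cong (suc (m + m) ∸_) (sym eq)) (m∸[m∸n]≡n i≤)) (∈-map⁺ position x∈)

  cond4-inherited : ∀ {k j l r} → Admissible k → Admissible j → k < j → cond4 S l r k → cond4 S l r j
  cond4-inherited {k} {j} (2≤k , _) (_ , j≤n) k<j = Sum.map (sub _) (Sum.map₂ (Product.map₂ (sub _)))
    where
    sub : ∀ s → s ∈ S 1 k → s ∈ S 1 j
    sub = proj₂ (proj₂ nested) k j 2≤k k<j j≤n

  open Enumeration N (cond4 S) Admissible positions
    positions-unique positions-sound positions-complete cond4-inherited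

  N≡2m+2 : N ≡ 2 * m + 2
  N≡2m+2 = trans (cong (λ x → suc (suc (m + x))) (sym (+-identityʳ m))) (+-comm 2 (2 * m))

  fromTo-valid : ValidLabels (fromTo 2 n)
  fromTo-valid = fromTo-increasing 2 n , All.tabulate ∈-fromTo⁻

  count-fromTo : ∀ d a → suc n ∸ a ≡ d →
    count (fromTo a n) ≡ product (map (λ k → n + 1 + length (S 1 k) ∸ k) (fromTo a n))
  count-fromTo d a _ with a ≤? n
  count-fromTo d a _ | no a≰n rewrite fromTo-empty (≰⇒> a≰n) = refl
  count-fromTo zero a eq | yes a≤n = ⊥-elim (m>n⇒m∸n≢0 (s≤s a≤n) eq)
  count-fromTo (suc d) a eq | yes a≤n rewrite fromTo-unfold a≤n =
    cong₂ _*_ factor (count-fromTo d (suc a) (suc-injective (trans (sym (+-∸-assoc 1 a≤n)) eq)))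
    where
    open ≡-Reasoning
    s = length (S 1 a)
    factor : length (positions a) + length (fromTo (suc a) n) ≡ n + 1 + s ∸ a
    factor = begin
      suc (length (map position (S 1 a))) + length (fromTo (suc a) n)
        ≡⟨ cong₂ _+_ (cong suc (length-map position (S 1 a))) (length-fromTo (suc a) n) ⟩
      suc s + (n ∸ a)   ≡⟨ +-comm (suc s) (n ∸ a) ⟩
      n ∸ a + suc s     ≡⟨ +-∸-comm (suc s) a≤n ⟨
      n + suc s ∸ a     ≡⟨ cong (_∸ a) (+-assoc n 1 s) ⟨
      n + 1 + s ∸ a     ∎

  trees : List Tree
  trees = map toTree (forests (fromTo 2 n))

  toTree-InT : 1 ≤ n → ∀ {F} → IsForestOn (fromTo 2 n) F → InT n S (toTree F)
  toTree-InT 1≤n {w ∷ ws} (len , perm , heads) =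
    chain w , map chain ws , refl ,
    trans (cong suc (length-map chain ws)) (trans len N≡2m+2) ,
    OneChild-chain w ∷ Allₚ.map⁺ (All.universal OneChild-chain ws) ,
    subst (_↭ fromTo 1 n) (sym (labels-toTree w ws))
      (subst (1 ∷ concat (w ∷ ws) ↭_) (sym (fromTo-unfold 1≤n)) (↭-prep 1 perm)) ,
    HeadsSatisfy⇒SibOK (cond4 S) (λ _ → inj₂ (inj₁ refl)) w ws
      (subst (λ z → HeadsSatisfy (cond4 S) 0 z (w ∷ ws)) (sym len) heads)

  InT⇒toTree : 1 ≤ n → ∀ {t} → InT n S t → ∃[ F ] t ≡ toTree F × IsForestOn (fromTo 2 n) F
  InT⇒toTree 1≤n (c , cs , refl , len , oc ∷ ocs , lab , sib)
    with w , refl ← OneChild⇒chain c oc | ws , refl ← All-OneChild⇒map-chain cs ocs =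
    w ∷ ws , refl , len' , perm ,
    subst (λ z → HeadsSatisfy (cond4 S) 0 z (w ∷ ws)) len' (SibOK⇒HeadsSatisfy (cond4 S) w ws sib)
    where
    len' : length (w ∷ ws) ≡ N
    len' = trans (cong suc (sym (length-map chain ws))) (trans len (sym N≡2m+2))
    perm : concat (w ∷ ws) ↭ fromTo 2 n
    perm = drop-∷ (subst (_↭ 1 ∷ fromTo 2 n) (labels-toTree w ws)
                    (subst (labels (toTree (w ∷ ws)) ↭_) (fromTo-unfold 1≤n) lab))

  trees-unique : Unique trees
  trees-unique = Unique.map⁺ toTree-injective (forests-unique fromTo-valid)

  ∈-trees⇔InT : 1 ≤ n → ∀ t → (t ∈ trees) ⇔ InT n S t
  ∈-trees⇔InT 1≤n t = mk⇔ sound complete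
    where
    sound : t ∈ trees → InT n S t
    sound t∈ with F , F∈ , refl ← ∈-map⁻ toTree t∈ = toTree-InT 1≤n (forests-sound fromTo-valid F∈)
    complete : InT n S t → t ∈ trees
    complete t-in with F , refl , F-on ← InT⇒toTree 1≤n t-in =
      ∈-map⁺ toTree (forests-complete fromTo-valid F-on)

  length-trees : length trees ≡ rhs n S
  length-trees = begin
    length trees                   ≡⟨ length-map toTree (forests (fromTo 2 n)) ⟩
    length (forests (fromTo 2 n))  ≡⟨ length-forests (fromTo 2 n) ⟩
    count (fromTo 2 n)             ≡⟨ count-fromTo _ 2 refl ⟩
    rhs n S                        ∎
    where open ≡-Reasoning

lemma6p1 : (n : ℕ) → 1 ≤ n → (S : Family) → IsDeformation n S → IsNestedIsh n S →
    Σ (List Tree) λ ts →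
        Unique ts
      × (∀ t → (t ∈ ts) ⇔ InT n S t)
      × length ts ≡ rhs n S
lemma6p1 n 1≤n S deformation nested = trees , trees-unique , ∈-trees⇔InT 1≤n , length-trees
  where open NestedIsh n S deformation nested
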